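{- Let $\Phi_t$ be a derivation in system $\mathcal{V}$ with subject $t$, let $(\Phi_u^i)_{i\in I}$ be derivations with common subject $u$ such that the typed substitution of $x$ by $(\Phi_u^i)_{i\in I}$ in $\Phi_t$ is defined, and let $\Psi$ be any derivation resulting from this (nondeterministic) typed substitution; $\Psi$ has subject $t\{x:=u\}$. Let $p\in\mathrm{oc}(t)$. Then: (1) $p\in\mathrm{toc}(\Phi_t)$ iff $p\in\mathrm{toc}(\Psi)$; (2) $q\in\mathrm{toc}(\Phi_u^k)$ for some $k\in I$ iff there exists $p\in\mathrm{toc}(\Phi_t)$ such that $t|_p=x$ and $pq\in\mathrm{toc}(\Psi)$.
   Context: Pure $\lambda$-terms; occurrences: words over $\{0,1\}$ with $\mathrm{oc}(x)=\{\epsilon\}$, $\mathrm{oc}(t\,u)=\{\epsilon\}\cup0\cdot\mathrm{oc}(t)\cup1\cdot\mathrm{oc}(u)$, $\mathrm{oc}(\lambda x.t)=\{\epsilon\}\cup0\cdot\mathrm{oc}(t)$. System $\mathcal{V}$: types $\tau::=\mathtt{a}\mid\alpha\mid\mathcal{M}\to\tau$, $\mathcal{M}$ finite multisets of types; contexts map variables to multisets (finite support), summed pointwise by multiset union; $\Phi(x)$ denotes the multiset assigned to $x$ in the conclusion context of $\Phi$ and $\mathrm{type}(\Phi)$ its conclusion type. Rules: (ax) $x:[\tau]\vdash x:\tau$; (val) $\emptyset\vdash\lambda x.t:\mathtt{a}$; ($\to$i) from $\Gamma\vdash t:\tau$ infer $\Gamma\setminus x\vdash\lambda x.t:\Gamma(x)\to\tau$;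 ($\to$e) from $\Gamma\vdash t:[\sigma_i]_{i\in I}\to\tau$ and $(\Delta_i\vdash u:\sigma_i)_{i\in I}$ infer $\Gamma+\sum_i\Delta_i\vdash t\,u:\tau$. Typed occurrences: $\mathrm{toc}(\Phi)=\{\epsilon\}$ for (ax),(val); $\{\epsilon\}\cup0\cdot\mathrm{toc}(\Phi_t)$ for ($\to$i) with premise $\Phi_t$; $\{\epsilon\}\cup0\cdot\mathrm{toc}(\Phi_t)\cup\bigcup_{i}1\cdot\mathrm{toc}(\Phi_u^i)$ for ($\to$e) with premises $\Phi_t,(\Phi_u^i)_i$. Typed substitution $x\{\!\{(\Phi_u^i)_{i\in I}\}\!\}\Phi_t$, defined only when $\Phi_t(x)=[\mathrm{type}(\Phi_u^i)]_{i\in I}$, by induction on $\Phi_t$ (avoiding variable capture): if $\Phi_t$ is (ax) on $x$ (then $I=\{i_0\}$) the result is $\Phi_u^{i_0}$; if (ax) on $y\ne x$, the result is $\Phi_t$; if (val) with subject $\lambda y.t'$, the result is (val) with subject $\lambda y.t'\{x:=u\}$; if ($\to$i) on $y$ with premise $\Phi_{t'}$, the result is ($\to$i) on $y$ applied to $x\{\!\{(\Phi_u^i)_{i\in I}\}\!\}\Phi_{t'}$; if ($\to$e) with subject $r\,s$ and premises $\Phi_r,(\Phi_s^j)_{j\in J}$, choose any decomposition $I=I'\uplus\biguplus_{j\in J}I_j$ with $\Phi_r(x)=[\mathrm{type}(\Phi_u^i)]_{i\in I'}$ and $\Phi_s^j(x)=[\mathrm{type}(\Phi_u^i)]_{i\in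 I_j}$, and the result is ($\to$e) with subject $r\{x:=u\}\,s\{x:=u\}$ and premises $x\{\!\{(\Phi_u^i)_{i\in I'}\}\!\}\Phi_r$ and $(x\{\!\{(\Phi_u^i)_{i\in I_j}\}\!\}\Phi_s^j)_{j\in J}$. -}

module Defs where

open import Data.Nat using (ℕ; _≡ᵇ_)
open import Data.Bool using (if_then_else_)
open import Data.List using (List; []; _∷_; _++_; concat)
open import Data.List.Relation.Unary.Any using (Any)
open import Data.List.Relation.Binary.Permutation.Propositional using (_↭_)
open import Data.Maybe using (Maybe; just; nothing)
open import Data.Product using (Σ; _×_)
open import Relation.Binary.PropositionalEquality using (_≡_; _≢_)
open import Relation.Nullary using (¬_)

data Term : Set where
  var : ℕ → Term
  lam : ℕ → Term → Term
  app : Term → Term → Term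

data FreeIn (y : ℕ) : Term → Set where
  fv-var : FreeIn y (var y)
  fv-lam : ∀ {z t} → y ≢ z → FreeIn y t → FreeIn y (lam z t)
  fv-appˡ : ∀ {t s} → FreeIn y t → FreeIn y (app t s)
  fv-appʳ : ∀ {t s} → FreeIn y s → FreeIn y (app t s)

data BoundIn (y : ℕ) : Term → Set where
  bv-here : ∀ {t} → BoundIn y (lam y t)
  bv-lam  : ∀ {z t} → BoundIn y t → BoundIn y (lam z t)
  bv-appˡ : ∀ {t s} → BoundIn y t → BoundIn y (app t s)
  bv-appʳ : ∀ {t s} → BoundIn y s → BoundIn y (app t s)

-- Variable convention for t{x:=u}: no bound variable of t is x or free in u.
-- Under it, the (naive) substitution below is capture-avoiding substitution.
VarConvention : ℕ → Term → Term → Set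
VarConvention x u t = ∀ y → BoundIn y t → (y ≢ x) × (¬ FreeIn y u)

_[_:=_] : Term → ℕ → Term → Term
var y   [ x := u ] = if y ≡ᵇ x then u else var y
lam y t [ x := u ] = lam y (t [ x := u ])
app t s [ x := u ] = app (t [ x := u ]) (s [ x := u ])

data Dir : Set where
  d0 d1 : Dir

Pos : Set
Pos = List Dir

data _∈oc_ : Pos → Term → Set where
  oc-ε   : ∀ {t} → [] ∈oc t
  oc-lam : ∀ {p y t} → p ∈oc t → (d0 ∷ p) ∈oc lam y t
  oc-appˡ : ∀ {p t s} → p ∈oc t → (d0 ∷ p) ∈oc app t s
  oc-appʳ : ∀ {p t s} → p ∈oc s → (d1 ∷ p) ∈oc app t s

_∣_ : Term → Pos → Maybe Term
t ∣ [] = just t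
lam y t ∣ (d0 ∷ p) = t ∣ p
app t s ∣ (d0 ∷ p) = t ∣ p
app t s ∣ (d1 ∷ p) = s ∣ p
_ ∣ _ = nothing

-- Types of system V.  Multisets of types are lists, compared up to
-- permutation (and, recursively, up to the induced equality of types).

data Ty : Set where
  a   : Ty
  tv  : ℕ → Ty
  _⇒_ : List Ty → Ty → Ty

infixr 5 _⇒_

mutual
  data _≈_ : Ty → Ty → Set where
    a≈  : a ≈ a
    tv≈ : ∀ {n} → tv n ≈ tv n
    ⇒≈  : ∀ {M N τ σ} → M ≈ₘ N → τ ≈ σ → (M ⇒ τ) ≈ (N ⇒ σ)

  data _≈ₘ_ : List Ty → List Ty → Set where
    []ₘ   : [] ≈ₘ []
    consₘ : ∀ {τ σ M N} → τ ≈ σ → M ≈ₘ N → (τ ∷ M) ≈ₘ (σ ∷ N)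
    swapₘ : ∀ {τ σ M} → (τ ∷ σ ∷ M) ≈ₘ (σ ∷ τ ∷ M)
    transₘ : ∀ {M N K} → M ≈ₘ N → N ≈ₘ K → M ≈ₘ K

ArrowFor : Ty → List Ty → Set
ArrowFor T Ns = Σ (List Ty) λ M → Σ Ty λ τ → (T ≡ (M ⇒ τ)) × (M ≈ₘ Ns)

Ctx : Set
Ctx = ℕ → List Ty

-- Derivations of system V, indexed by their subject.  The conclusion
-- context (ctx) and type (ty) are computed from the derivation.

mutual
  data Deriv : Term → Set where
    ax  : (x : ℕ) (τ : Ty) → Deriv (var x)
    val : ∀ {y t} → Deriv (lam y t)
    abs : ∀ {y t} → Deriv t → Deriv (lam y t)
    app : ∀ {t u} (Φ : Deriv t) (Φs : List (Deriv u)) →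
          ArrowFor (ty Φ) (tys Φs) → Deriv (app t u)

  ty : ∀ {t} → Deriv t → Ty
  ty (ax x τ) = τ
  ty val = a
  ty (abs {y} Φ) = ctx Φ y ⇒ ty Φ
  ty (app Φ Φs (M Data.Product., τ Data.Product., _)) = τ

  tys : ∀ {t} → List (Deriv t) → List Ty
  tys [] = []
  tys (Φ ∷ Φs) = ty Φ ∷ tys Φs

  ctx : ∀ {t} → Deriv t → Ctx
  ctx (ax x τ) z = if z ≡ᵇ x then τ ∷ [] else []
  ctx val z = []
  ctx (abs {y} Φ) z = if z ≡ᵇ y then [] else ctx Φ z
  ctx (app Φ Φs _) z = ctx Φ z ++ ctxs Φs z

  ctxs : ∀ {t} → List (Deriv t) → Ctx
  ctxs [] z = []
  ctxs (Φ ∷ Φs) z = ctx Φ z ++ ctxs Φs z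

data _∈toc_ : ∀ {t} → Pos → Deriv t → Set where
  toc-ε    : ∀ {t} {Φ : Deriv t} → [] ∈toc Φ
  toc-abs  : ∀ {p y t} {Φ : Deriv t} → p ∈toc Φ → (d0 ∷ p) ∈toc abs {y} Φ
  toc-appˡ : ∀ {p t u} {Φ : Deriv t} {Φs : List (Deriv u)} {c} →
             p ∈toc Φ → (d0 ∷ p) ∈toc app Φ Φs c
  toc-appʳ : ∀ {p t u} {Φ : Deriv t} {Φs : List (Deriv u)} {c} →
             Any (λ Ψ → p ∈toc Ψ) Φs → (d1 ∷ p) ∈toc app Φ Φs c

-- Typed substitution  x{{(Φu^i)_i}}Φt ⇝ Ψ  as a relation (it is
-- nondeterministic: the decomposition of I in the (→e) case is chosen).
-- The family (Φu^i)_{i∈I} is a list; decompositions of I are given as a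
-- permutation of the list onto  Φus' ++ concat Φuss .

module _ (x : ℕ) {u : Term} where
  mutual
    data TSubst : List (Deriv u) → ∀ {t} → Deriv t → ∀ {s} → Deriv s → Set where
      ts-ax-hit : ∀ {τ} (Φu : Deriv u) → τ ≈ ty Φu →
                  TSubst (Φu ∷ []) (ax x τ) Φu
      ts-ax-miss : ∀ {y τ} → y ≢ x → TSubst [] (ax y τ) (ax y τ)
      ts-val : ∀ {y t} → TSubst [] (val {y} {t}) (val {y} {t [ x := u ]})
      ts-abs : ∀ {Φus y t s} {Φ : Deriv t} {Ψ : Deriv s} →
               TSubst Φus Φ Ψ → TSubst Φus (abs {y} Φ) (abs {y} Ψ)
      ts-app : ∀ {Φus r s r' s'} {Φr : Deriv r} {Φss : List (Deriv s)}
                 {c : ArrowFor (ty Φr) (tys Φss)}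
                 (Φus' : List (Deriv u)) (Φuss : List (List (Deriv u))) →
               Φus ↭ (Φus' ++ concat Φuss) →
               ctx Φr x ≈ₘ tys Φus' →
               (Ψr : Deriv r') → TSubst Φus' Φr Ψr →
               (Ψss : List (Deriv s')) → s' ≡ s [ x := u ] →
               TSubsts Φuss Φss Ψss →
               (c' : ArrowFor (ty Ψr) (tys Ψss)) →
               TSubst Φus (app Φr Φss c) (app Ψr Ψss c')

    data TSubsts : List (List (Deriv u)) → ∀ {s} → List (Deriv s) → ∀ {s'} → List (Deriv s') → Set where
      []ₜ  : ∀ {s s'} → TSubsts [] ([] {A = Deriv s}) ([] {A = Deriv s'})
      _∷ₜ_ : ∀ {Φus Φuss s s'} {Φs : Deriv s} {Φss : List (Deriv s)}
               {Ψ : Deriv s'} {Ψss : List (Deriv s')} →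
             (ctx Φs x ≈ₘ tys Φus) × TSubst Φus Φs Ψ →
             TSubsts Φuss Φss Ψss →
             TSubsts (Φus ∷ Φuss) (Φs ∷ Φss) (Ψ ∷ Ψss)

module Submission where

open import Defs
open import Data.Nat using (ℕ)
open import Data.List using (List; _++_; []; _∷_)
open import Data.List.Relation.Unary.Any using (Any; here; there)
open import Data.List.Relation.Unary.Any.Properties using (++⁺ˡ; ++⁺ʳ; ++⁻; concat⁺; concat⁻)
open import Data.List.Relation.Binary.Permutation.Propositional using (↭-sym)
open import Data.List.Relation.Binary.Permutation.Propositional.Properties using (Any-resp-↭)
open import Data.Maybe using (just)
open import Data.Product using (_×_; ∃; _,_)
open import Data.Sum using (inj₁; inj₂)
open import Data.Empty using (⊥-elim)
open import Function.Bundles using (_⇔_; mk⇔)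
open import Relation.Binary.PropositionalEquality using (_≡_; refl)

-- Typed substitution rebuilds Φt rule by rule and replaces each typed
-- x-leaf by one of the Φu^i, the permutation in the (→e) case only
-- redistributing the Φu^i among the premises.  Hence, by induction on the
-- substitution, the typed occurrences of Ψ inside oc(t) are those of Φt,
-- and those below a typed x-leaf p are p followed by a typed occurrence of
-- the Φu^i grafted there.

module _ (x : ℕ) {u : Term} where

  Grafted : ∀ {t s} → Deriv t → Deriv s → Pos → Set
  Grafted {t} Φ Ψ q = ∃ λ p → (p ∈toc Φ) × ((t ∣ p) ≡ just (var x)) × ((p ++ q) ∈toc Ψ)

  mutual
    toc-subst⁺ : ∀ {Φus t s} {Φ : Deriv t} {Ψ : Deriv s} → TSubst x {u} Φus Φ Ψ →
                 ∀ {p} → p ∈toc Φ → p ∈toc Ψ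
    toc-subst⁺ σ toc-ε = toc-ε
    toc-subst⁺ (ts-abs σ) (toc-abs h) = toc-abs (toc-subst⁺ σ h)
    toc-subst⁺ (ts-app _ _ _ _ _ σ _ _ _ _) (toc-appˡ h) = toc-appˡ (toc-subst⁺ σ h)
    toc-subst⁺ (ts-app _ _ _ _ _ _ _ _ σs _) (toc-appʳ hs) = toc-appʳ (toc-substs⁺ σs hs)

    toc-substs⁺ : ∀ {Φuss s s'} {Φs : List (Deriv s)} {Ψs : List (Deriv s')} →
                  TSubsts x {u} Φuss Φs Ψs →
                  ∀ {p} → Any (p ∈toc_) Φs → Any (p ∈toc_) Ψs
    toc-substs⁺ ((_ , σ) ∷ₜ _) (here h) = here (toc-subst⁺ σ h)
    toc-substs⁺ (_ ∷ₜ σs) (there hs) = there (toc-substs⁺ σs hs)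

  -- Restricting to p ∈ oc(t) rules out the occurrences of a grafted Φu^i.
  mutual
    toc-subst⁻ : ∀ {Φus t s} {Φ : Deriv t} {Ψ : Deriv s} → TSubst x {u} Φus Φ Ψ →
                 ∀ {p} → p ∈oc t → p ∈toc Ψ → p ∈toc Φ
    toc-subst⁻ σ oc-ε _ = toc-ε
    toc-subst⁻ (ts-abs σ) (oc-lam o) (toc-abs h) = toc-abs (toc-subst⁻ σ o h)
    toc-subst⁻ (ts-app _ _ _ _ _ σ _ _ _ _) (oc-appˡ o) (toc-appˡ h) = toc-appˡ (toc-subst⁻ σ o h)
    toc-subst⁻ (ts-app _ _ _ _ _ _ _ _ σs _) (oc-appʳ o) (toc-appʳ hs) = toc-appʳ (toc-substs⁻ σs o hs)

    toc-substs⁻ : ∀ {Φuss s s'} {Φs : List (Deriv s)} {Ψs : List (Deriv s')} →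
                  TSubsts x {u} Φuss Φs Ψs →
                  ∀ {p} → p ∈oc s → Any (p ∈toc_) Ψs → Any (p ∈toc_) Φs
    toc-substs⁻ ((_ , σ) ∷ₜ _) o (here h) = here (toc-subst⁻ σ o h)
    toc-substs⁻ (_ ∷ₜ σs) o (there hs) = there (toc-substs⁻ σs o hs)

  mutual
    toc-graft⁺ : ∀ {Φus t s} {Φ : Deriv t} {Ψ : Deriv s} → TSubst x {u} Φus Φ Ψ →
                 ∀ {q} → Any (q ∈toc_) Φus → Grafted Φ Ψ q
    toc-graft⁺ (ts-ax-hit _ _) (here h) = [] , toc-ε , refl , h
    toc-graft⁺ (ts-abs σ) hs with toc-graft⁺ σ hs
    ... | p , h , e , h' = d0 ∷ p , toc-abs h , e , toc-abs h'
    toc-graft⁺ (ts-app Φus' Φuss perm _ _ σ _ _ σs _) hs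
      with ++⁻ Φus' (Any-resp-↭ perm hs)
    ... | inj₁ hsʳ with toc-graft⁺ σ hsʳ
    ...   | p , h , e , h' = d0 ∷ p , toc-appˡ h , e , toc-appˡ h'
    toc-graft⁺ (ts-app Φus' Φuss perm _ _ σ _ _ σs _) hs
        | inj₂ hsˢ with toc-grafts⁺ σs (concat⁻ Φuss hsˢ)
    ...   | p , h , e , h' = d1 ∷ p , toc-appʳ h , e , toc-appʳ h'

    toc-grafts⁺ : ∀ {Φuss s s'} {Φs : List (Deriv s)} {Ψs : List (Deriv s')} →
                  TSubsts x {u} Φuss Φs Ψs → ∀ {q} → Any (Any (q ∈toc_)) Φuss →
                  ∃ λ p → Any (p ∈toc_) Φs × ((s ∣ p) ≡ just (var x)) × Any ((p ++ q) ∈toc_) Ψs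
    toc-grafts⁺ ((_ , σ) ∷ₜ _) (here hs) with toc-graft⁺ σ hs
    ... | p , h , e , h' = p , here h , e , here h'
    toc-grafts⁺ (_ ∷ₜ σs) (there hs) with toc-grafts⁺ σs hs
    ... | p , h , e , h' = p , there h , e , there h'

  -- Only t ∣ p ≡ just (var x) is needed: it already makes p an occurrence of t.
  mutual
    toc-graft⁻ : ∀ {Φus t s} {Φ : Deriv t} {Ψ : Deriv s} → TSubst x {u} Φus Φ Ψ →
                 ∀ {p q} → (t ∣ p) ≡ just (var x) → (p ++ q) ∈toc Ψ → Any (q ∈toc_) Φus
    toc-graft⁻ (ts-ax-hit _ _) {[]} refl h = here h
    toc-graft⁻ (ts-ax-miss y≢x) {[]} refl _ = ⊥-elim (y≢x refl)
    toc-graft⁻ (ts-abs σ) {d0 ∷ _} e (toc-abs h) = toc-graft⁻ σ e h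
    toc-graft⁻ (ts-app Φus' _ perm _ _ σ _ _ _ _) {d0 ∷ _} e (toc-appˡ h) =
      Any-resp-↭ (↭-sym perm) (++⁺ˡ (toc-graft⁻ σ e h))
    toc-graft⁻ (ts-app Φus' _ perm _ _ _ _ _ σs _) {d1 ∷ _} e (toc-appʳ hs) =
      Any-resp-↭ (↭-sym perm) (++⁺ʳ Φus' (concat⁺ (toc-grafts⁻ σs e hs)))

    toc-grafts⁻ : ∀ {Φuss s s'} {Φs : List (Deriv s)} {Ψs : List (Deriv s')} →
                  TSubsts x {u} Φuss Φs Ψs → ∀ {p q} → (s ∣ p) ≡ just (var x) →
                  Any ((p ++ q) ∈toc_) Ψs → Any (Any (q ∈toc_)) Φuss
    toc-grafts⁻ ((_ , σ) ∷ₜ _) e (here h) = here (toc-graft⁻ σ e h)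
    toc-grafts⁻ (_ ∷ₜ σs) e (there hs) = there (toc-grafts⁻ σs e hs)

-- The variable convention and the context condition are not used: the
-- TSubst derivation already records every choice the substitution makes.
mainTheorem9 : (x : ℕ) {t u : Term} (Φt : Deriv t) (Φus : List (Deriv u))
    (Ψ : Deriv (t [ x := u ])) →
    VarConvention x u t →
    ctx Φt x ≈ₘ tys Φus →
    TSubst x Φus Φt Ψ →
    ((p : Pos) → p ∈oc t → (p ∈toc Φt ⇔ p ∈toc Ψ))
    × ((q : Pos) →
       (Any (λ Φu → q ∈toc Φu) Φus
        ⇔ ∃ (λ p → (p ∈toc Φt) × ((t ∣ p) ≡ just (var x)) × ((p ++ q) ∈toc Ψ))))
mainTheorem9 x Φt Φus Ψ _ _ σ =
    (λ p o → mk⇔ (toc-subst⁺ x σ) (toc-subst⁻ x σ o))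
  , (λ q → mk⇔ (toc-graft⁺ x σ) (λ { (p , _ , e , h) → toc-graft⁻ x σ e h }))
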